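{- For every block graph $G$, ${\rm b}^{\ast}(G)=m^{\ast}(G)+1$. In particular, ${\rm b}^{\ast}(T)=m^{\ast}(T)+1$ for every tree $T$.
   Context: Graphs are finite, simple, undirected; $d(v)$ is the degree and $N(v)$ the neighbourhood of $v$. A block graph is a graph in which every block (maximal 2-connected subgraph or bridge) is a complete graph. For a proper coloring $c:V(G)\to\{1,\dots,k\}$, a vertex $u$ is a b-vertex if every color $j\in\{1,\dots,k\}\setminus\{c(u)\}$ appears on a neighbour of $u$. A ${\rm b}^{\ast}$-coloring with $k$ colors is a proper coloring $c:V(G)\to\{1,\dots,k\}$ containing a b-vertex $u$ with $c(u)=k$ such that for each $j<k$, $u$ is adjacent to a b-vertex of color $j$; ${\rm b}^{\ast}(G)$ is the maximum $k$ for which $G$ has such a coloring. $m^{\ast}(G)$ is the maximum $k\ge0$ such that there exist $u\in V(G)$ and distinct $u_1,\dots,u_k\in N(u)$ with $d(u_i)\ge k$ for all $i$. -}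

module Defs where

open import Data.Bool using (Bool; true; false; T)
open import Data.Nat using (ℕ; zero; suc; _≤_; _<_)
open import Data.Fin using (Fin)
open import Data.List using (length; filterᵇ; allFin)
open import Data.Product using (Σ; _×_; ∃)
open import Relation.Binary.PropositionalEquality using (_≡_; _≢_)
open import Function.Definitions using (Injective)

record Graph : Set where
  field
    n     : ℕ
    adj   : Fin n → Fin n → Bool
    sym   : ∀ u v → adj u v ≡ adj v u
    irref : ∀ v → adj v v ≡ false

open Graph public

Vertex : Graph → Set
Vertex G = Fin (n G)

Adj : (G : Graph) → Vertex G → Vertex G → Set
Adj G u v = T (adj G u v)

degree : (G : Graph) → Vertex G → ℕ
degree G v = length (filterᵇ (adj G v) (allFin (n G)))

VSet : Graph → Set₁
VSet G = Vertex G → Set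

_⊆V_ : {G : Graph} → VSet G → VSet G → Set
S ⊆V S' = ∀ v → S v → S' v

data WalkIn (G : Graph) (S : VSet G) : Vertex G → Vertex G → Set where
  here : ∀ {u} → S u → WalkIn G S u u
  step : ∀ {u v w} → S u → Adj G u v → WalkIn G S v w → WalkIn G S u w

Connected : (G : Graph) → VSet G → Set
Connected G S = ∀ u v → S u → S v → WalkIn G S u v

_─_ : {G : Graph} → VSet G → Vertex G → VSet G
(S ─ x) v = S v × v ≢ x

NonSeparable : (G : Graph) → VSet G → Set
NonSeparable G S = Connected G S × (∀ x → S x → Connected G (_─_ {G} S x))

-- S is (the vertex set of) a block: a maximal connected subgraph without
-- a cut-vertex (maximal 2-connected subgraph, bridge, or isolated vertex)
IsBlock : (G : Graph) → VSet G → Set₁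
IsBlock G S = NonSeparable G S × (∀ S' → _⊆V_ {G} S S' → NonSeparable G S' → _⊆V_ {G} S' S)

IsClique : (G : Graph) → VSet G → Set
IsClique G S = ∀ u v → S u → S v → u ≢ v → Adj G u v

BlockGraph : Graph → Set₁
BlockGraph G = ∀ S → IsBlock G S → IsClique G S

ProperColoring : (G : Graph) → ℕ → (Vertex G → ℕ) → Set
ProperColoring G k c =
  (∀ v → 1 ≤ c v × c v ≤ k) × (∀ u v → Adj G u v → c u ≢ c v)

IsBVertex : (G : Graph) → ℕ → (Vertex G → ℕ) → Vertex G → Set
IsBVertex G k c u =
  ∀ j → 1 ≤ j → j ≤ k → j ≢ c u → ∃ λ w → Adj G u w × c w ≡ j

IsBStarColoring : (G : Graph) → ℕ → (Vertex G → ℕ) → Set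
IsBStarColoring G k c =
  ProperColoring G k c ×
  ∃ λ u → c u ≡ k × IsBVertex G k c u ×
    (∀ j → 1 ≤ j → j < k → ∃ λ w → Adj G u w × c w ≡ j × IsBVertex G k c w)

HasBStarColoring : Graph → ℕ → Set
HasBStarColoring G k = ∃ λ c → IsBStarColoring G k c

-- the property whose maximum k defines m*(G)
HasMStar : Graph → ℕ → Set
HasMStar G k = ∃ λ u → Σ (Fin k → Vertex G) λ f →
  Injective _≡_ _≡_ f × (∀ i → Adj G u (f i) × k ≤ degree G (f i))

IsMaximum : (ℕ → Set) → ℕ → Set
IsMaximum P m = P m × (∀ k → P k → k ≤ m)

{-# OPTIONS --safe #-}
module Submission where

-- In a b*-colouring with k + 1 colours some vertex has b-vertex neighbours of colours 1, …, k,
-- and a b-vertex sees the k other colours, so it has degree at least k: b*(G) ≤ m*(G) + 1 for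
-- every graph.
--
-- Conversely let u and its neighbours f₀, …, f_{m-1} of degree at least m witness m = m*(G).
-- Colour u with m + 1 and fᵢ with i + 1, then colour the other vertices one at a time: the
-- neighbours of u first, afterwards a vertex next to the coloured part whenever there is one.
-- In a block graph every cycle induces a clique. Hence the coloured neighbours of the next vertex
-- y are pairwise adjacent, each of them has degree at least their number, and by maximality of m
-- a colour is still free at y. While y is a neighbour of u, a colour free at y is also missing
-- around every fᵢ adjacent to y (4-cycles have chords); later y is adjacent to at most one fᵢ, and
-- if that fᵢ is not yet a b-vertex, y gets a colour missing around fᵢ. So every fᵢ either is a
-- b-vertex or has pairwise distinct colours on its neighbourhood; in the end the latter means m
-- distinct colours besides its own, and fᵢ is a b-vertex after all.

open import Defs
open import Data.Nat using (ℕ; suc)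

open import Data.Bool using (true; T)
open import Data.Bool.Properties using (T?)
open import Data.Empty using (⊥-elim)
open import Data.Fin using (Fin; zero; suc; toℕ; fromℕ<; _≟_; punchIn)
open import Data.Fin.Properties
  using (toℕ-fromℕ<; toℕ-injective; toℕ<n; any?; injective⇒≤; punchIn-injective;
         punchInᵢ≢i)
open import Data.Fin.Subset using (Subset; _⊆_; _⊂_; _⊃_)
  renaming (_∈_ to _∈ˢ_)
open import Data.Fin.Subset.Induction using (⊃-wellFounded)
open import Data.Fin.Subset.Properties using (_∈?_)
open import Data.List using (List; []; _∷_; filterᵇ; allFin; lookup)
open import Data.List.Membership.Propositional using (_∈_; _∉_)
open import Data.List.Membership.Propositional.Properties using (∈-filter⁺; ∈-allFin; ∈-lookup)
open import Data.List.Relation.Unary.Any as Any using (here; there)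
open import Data.List.Relation.Unary.Any.Properties using (lookup-index)
open import Data.List.Relation.Unary.All as All using ()
open import Data.List.Relation.Unary.All.Properties using (all-filter)
open import Data.List.Relation.Unary.AllPairs using (AllPairs; _∷_)
import Data.List.Relation.Unary.Unique.Propositional.Properties as Unique
open import Data.Nat using (zero; _≤_; z≤n; s≤s; s≤s⁻¹)
open import Data.Nat.Properties
  using (suc-injective; 1+n≢0; 1+n≰n; ≤-refl; m≤n⇒m≤1+n; <⇒≢; <⇒≱; >⇒≢; n≢0⇒n>0; ≤∧≢⇒<;
         m<1+n⇒m≤n)
  renaming (_≟_ to _≟ℕ_)
open import Data.Product using (∃; ∃₂; _×_; _,_; proj₁; proj₂; map₁)
open import Data.Sum using (_⊎_; inj₁; inj₂; [_,_]; fromInj₁)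
open import Data.Unit using (⊤; tt)
open import Data.Vec using (tabulate)
open import Data.Vec.Functional using (updateAt) renaming (_∷_ to _◂_)
open import Data.Vec.Functional.Properties using (updateAt-updates; updateAt-minimal)
open import Data.Vec.Properties using (lookup∘tabulate; lookup⇒[]=; []=⇒lookup)
open import Function using (_∘_; id; const)
open import Function.Definitions using (Injective)
import Induction.WellFounded as WF
open import Relation.Binary.Construct.On as On using ()
open import Relation.Binary.PropositionalEquality
  using (_≡_; _≢_; refl; trans; cong; subst; ≢-sym)
  renaming (sym to ≡-sym)
open import Relation.Nullary using (¬_; Dec; yes; no; does)
open import Relation.Nullary.Decidable
  using (dec-true; decidable-stable; ¬?; _×-dec_; ¬¬-excluded-middle)

colour : ∀ {k} → Fin k → ℕ
colour i = suc (toℕ i)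

colour-injective : ∀ {k} {i j : Fin k} → colour i ≡ colour j → i ≡ j
colour-injective = toℕ-injective ∘ suc-injective

colour-range : ∀ {k} (i : Fin k) → 1 ≤ colour i × colour i ≤ k
colour-range i = s≤s z≤n , toℕ<n i

colour≢1+k : ∀ {k} (i : Fin k) → colour i ≢ suc k
colour≢1+k i = <⇒≢ (toℕ<n i) ∘ suc-injective

colour-surjective : ∀ {k j} → 1 ≤ j → j ≤ k → ∃ λ (i : Fin k) → colour i ≡ j
colour-surjective {j = suc j} _ j<k = fromℕ< j<k , cong suc (toℕ-fromℕ< j<k)

labels-injective⇒injective : ∀ {I A B : Set} (c : A → B) {g : I → A} {h : I → B} →
  Injective _≡_ _≡_ h → (∀ i → c (g i) ≡ h i) → Injective _≡_ _≡_ g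
labels-injective⇒injective c h-injective g↦h {i} {j} eq =
  h-injective (trans (≡-sym (g↦h i)) (trans (cong c eq) (g↦h j)))

injective-colours⇒≤ : ∀ {r k} (g : Fin r → ℕ) → (∀ a → 1 ≤ g a × g a ≤ k) →
  Injective _≡_ _≡_ g → r ≤ k
injective-colours⇒≤ {r} {k} g range g-injective =
  injective⇒≤ (labels-injective⇒injective colour g-injective (proj₂ ∘ index))
  where
  index : ∀ a → ∃ λ (i : Fin k) → colour i ≡ g a
  index a = colour-surjective (proj₁ (range a)) (proj₂ (range a))

◂-injective : ∀ {A : Set} {r} {x : A} {g : Fin r → A} →
  (∀ a → g a ≢ x) → Injective _≡_ _≡_ g → Injective _≡_ _≡_ (x ◂ g)
◂-injective fresh g-injective {zero}  {zero}  _  = refl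
◂-injective fresh g-injective {zero}  {suc b} eq = ⊥-elim (fresh b (≡-sym eq))
◂-injective fresh g-injective {suc a} {zero}  eq = ⊥-elim (fresh a eq)
◂-injective fresh g-injective {suc a} {suc b} eq = cong suc (g-injective eq)

lookup-injective : ∀ {A : Set} {xs : List A} → AllPairs _≢_ xs →
  Injective _≡_ _≡_ (lookup xs)
lookup-injective (_ ∷ _)    {zero}  {zero}  _  = refl
lookup-injective (x≢ ∷ _)   {zero}  {suc j} eq = ⊥-elim (All.lookup x≢ (∈-lookup j) eq)
lookup-injective (x≢ ∷ _)   {suc i} {zero}  eq = ⊥-elim (All.lookup x≢ (∈-lookup i) (≡-sym eq))
lookup-injective (_ ∷ rest) {suc i} {suc j} eq = cong suc (lookup-injective rest eq)

¬¬-decidable : ∀ {n} (P : Fin n → Set) → ¬ ¬ (∀ i → Dec (P i))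
¬¬-decidable {zero}  P k = k λ ()
¬¬-decidable {suc n} P k = ¬¬-excluded-middle λ P₀? → ¬¬-decidable (P ∘ suc) λ P₊? →
  k λ { zero → P₀? ; (suc i) → P₊? i }

subset : ∀ {n} {P : Fin n → Set} → (∀ i → Dec (P i)) → Subset n
subset P? = tabulate (does ∘ P?)

∈-subset⁺ : ∀ {n} {P : Fin n → Set} (P? : ∀ i → Dec (P i)) {i} → P i → i ∈ˢ subset P?
∈-subset⁺ P? {i} Pi = lookup⇒[]= i _ (trans (lookup∘tabulate _ i) (dec-true (P? i) Pi))

∈-subset⁻ : ∀ {n} {P : Fin n → Set} (P? : ∀ i → Dec (P i)) {i} → i ∈ˢ subset P? → P i
∈-subset⁻ P? {i} i∈ =
  witness (P? i) (trans (≡-sym (lookup∘tabulate _ i)) ([]=⇒lookup i∈))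
  where
  witness : ∀ {A : Set} (A? : Dec A) → does A? ≡ true → A
  witness (yes a) _ = a
  witness (no _) ()

module Walks (G : Graph) where
  adj-sym : ∀ {u v} → Adj G u v → Adj G v u
  adj-sym {u} {v} = subst T (sym G u v)

  adj⇒≢ : ∀ {u v} → Adj G u v → u ≢ v
  adj⇒≢ {u} uu refl = subst T (irref G u) uu

  end∈ : ∀ {S a b} → WalkIn G S a b → S b
  end∈ (here b∈) = b∈
  end∈ (step _ _ w) = end∈ w

  mapʷ : ∀ {S S' : VSet G} {a b} → (∀ {v} → S v → S' v) →
    WalkIn G S a b → WalkIn G S' a b
  mapʷ f (here a∈) = here (f a∈)
  mapʷ f (step a∈ e w) = step (f a∈) e (mapʷ f w)

  _++ʷ_ : ∀ {S a b c} → WalkIn G S a b → WalkIn G S b c → WalkIn G S a c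
  here _ ++ʷ w' = w'
  step a∈ e w ++ʷ w' = step a∈ e (w ++ʷ w')

  snocʷ : ∀ {S a b c} → WalkIn G S a b → Adj G b c → S c → WalkIn G S a c
  snocʷ w e c∈ = w ++ʷ step (end∈ w) e (here c∈)

  reverseʷ : ∀ {S a b} → WalkIn G S a b → WalkIn G S b a
  reverseʷ (here a∈) = here a∈
  reverseʷ (step a∈ e w) = snocʷ (reverseʷ w) (adj-sym e) a∈

  connected-via : ∀ {S : VSet G} z → (∀ v → S v → WalkIn G S v z) → Connected G S
  connected-via z to-z a b a∈ b∈ = to-z a a∈ ++ʷ reverseʷ (to-z b b∈)

  nonSeparable-resp : ∀ {S S' : VSet G} → (∀ {v} → S v → S' v) → (∀ {v} → S' v → S v) →
    NonSeparable G S → NonSeparable G S'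
  nonSeparable-resp to from (connected , connected-─) =
    (λ a b a∈ b∈ → mapʷ to (connected a b (from a∈) (from b∈))) ,
    λ x x∈ a b a∈ b∈ → mapʷ (map₁ to)
      (connected-─ x (from x∈) a b (map₁ from a∈) (map₁ from b∈))

  crossing-edge : ∀ {S a b} {P : VSet G} → (∀ v → Dec (P v)) → WalkIn G S a b → ¬ P a → P b →
    ∃₂ λ v w → ¬ P v × P w × Adj G v w
  crossing-edge P? (here _) ¬Pa Pb = ⊥-elim (¬Pa Pb)
  crossing-edge P? (step {u = a} {v = v} _ e w) ¬Pa Pb with P? v
  ... | yes Pv = a , v , ¬Pa , Pv , e
  ... | no ¬Pv = crossing-edge P? w ¬Pv Pb

module Paths (G : Graph) where
  open Walks G
  open import Data.List.Membership.DecPropositional (_≟_ {n G})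
    using () renaming (_∈?_ to _∈ˡ?_)

  data Path : Vertex G → Vertex G → List (Vertex G) → Set where
    end  : ∀ {a} → Path a a (a ∷ [])
    cons : ∀ {a v b vs} → a ∉ vs → Adj G a v → Path v b vs → Path a b (a ∷ vs)

  first∈ : ∀ {a b vs} → Path a b vs → a ∈ vs
  first∈ end = here refl
  first∈ (cons _ _ _) = here refl

  last∈ : ∀ {a b vs} → Path a b vs → b ∈ vs
  last∈ end = here refl
  last∈ (cons _ _ p) = there (last∈ p)

  suffix : ∀ {a b vs v} → Path a b vs → v ∈ vs →
    ∃ λ ws → Path v b ws × (∀ {w} → w ∈ ws → w ∈ vs)
  suffix end (here refl) = _ , end , id
  suffix p@(cons _ _ _) (here refl) = _ , p , id
  suffix (cons _ _ p) (there v∈) with suffix p v∈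
  ... | ws , q , ws⊆ = ws , q , there ∘ ws⊆

  loop-erase : ∀ {S a b} → WalkIn G S a b →
    ∃ λ vs → Path a b vs × (∀ {v} → v ∈ vs → S v)
  loop-erase (here a∈) = _ , end , λ { (here refl) → a∈ }
  loop-erase {a = a} (step a∈ e w) with loop-erase w
  ... | vs , p , inS with a ∈ˡ? vs
  ...   | yes a∈vs = let ws , q , ws⊆ = suffix p a∈vs in ws , q , inS ∘ ws⊆
  ...   | no a∉vs =
    a ∷ vs , cons a∉vs e p , λ { (here refl) → a∈ ; (there v∈) → inS v∈ }

  to-last : ∀ {a b vs v} → Path a b vs → v ∈ vs → WalkIn G (_∈ vs) v b
  to-last end (here refl) = here (here refl)
  to-last (cons _ e p) (here refl) = step (here refl) e (mapʷ there (to-last p (first∈ p)))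
  to-last (cons _ _ p) (there v∈) = mapʷ there (to-last p v∈)

  -- Deleting x splits the path into the part before x and the part after it.
  reach-end-avoiding : ∀ {a b vs x v} → Path a b vs → x ∈ vs → v ∈ vs → v ≢ x →
    WalkIn G (_─_ {G} (_∈ vs) x) v a ⊎ WalkIn G (_─_ {G} (_∈ vs) x) v b
  reach-end-avoiding end (here refl) (here refl) v≢x = ⊥-elim (v≢x refl)
  reach-end-avoiding end (there ()) _ _
  reach-end-avoiding end _ (there ()) _
  reach-end-avoiding (cons _ _ _) _ (here refl) v≢x = inj₁ (here (here refl , v≢x))
  reach-end-avoiding (cons a∉ _ p) (here refl) (there v∈) _ =
    inj₂ (mapʷ (λ w∈ → there w∈ , λ { refl → a∉ w∈ }) (to-last p v∈))
  reach-end-avoiding {x = x} (cons a∉ e p) (there x∈) (there v∈) v≢x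
    with reach-end-avoiding p x∈ v∈ v≢x
  ... | inj₁ w = inj₁ (snocʷ (mapʷ (map₁ there) w) (adj-sym e) (here refl , λ { refl → a∉ x∈ }))
  ... | inj₂ w = inj₂ (mapʷ (map₁ there) w)

  Cycle : Vertex G → List (Vertex G) → VSet G
  Cycle y vs v = v ≡ y ⊎ v ∈ vs

  cycle-nonSeparable : ∀ {a b vs y} → Path a b vs → y ∉ vs → Adj G y a → Adj G y b →
    NonSeparable G (Cycle y vs)
  cycle-nonSeparable {a} {b} {vs} {y} p y∉ ya yb = connected-via y to-y , connected-─
    where
    to-y : ∀ v → Cycle y vs v → WalkIn G (Cycle y vs) v y
    to-y v (inj₁ refl) = here (inj₁ refl)
    to-y v (inj₂ v∈) = snocʷ (mapʷ inj₂ (to-last p v∈)) (adj-sym yb) (inj₁ refl)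
    connected-─ : ∀ x → Cycle y vs x → Connected G (_─_ {G} (Cycle y vs) x)
    connected-─ x (inj₁ refl) = connected-via b λ where
      v (inj₁ refl , v≢y) → ⊥-elim (v≢y refl)
      v (inj₂ v∈ , _) → mapʷ (λ w∈ → inj₂ w∈ , λ { refl → y∉ w∈ }) (to-last p v∈)
    connected-─ x (inj₂ x∈) = connected-via y λ
      { v (inj₁ refl , v≢x) → here (inj₁ refl , v≢x)
      ; v (inj₂ v∈ , v≢x) → [ via ya , via yb ] (reach-end-avoiding p x∈ v∈ v≢x) }
      where
      via : ∀ {v e} → Adj G y e → WalkIn G (_─_ {G} (_∈ vs) x) v e →
        WalkIn G (_─_ {G} (Cycle y vs) x) v y
      via ye w = snocʷ (mapʷ (map₁ inj₂) w) (adj-sym ye) (inj₁ refl , λ { refl → y∉ x∈ })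

module Neighbourhood (G : Graph) where
  open Walks G

  neighbours : Vertex G → List (Vertex G)
  neighbours v = filterᵇ (adj G v) (allFin (n G))

  neighbour : ∀ v → Fin (degree G v) → Vertex G
  neighbour v = lookup (neighbours v)

  neighbour-adj : ∀ v l → Adj G v (neighbour v l)
  neighbour-adj v l = All.lookup (all-filter (T? ∘ adj G v) (allFin (n G))) (∈-lookup l)

  neighbour-injective : ∀ v → Injective _≡_ _≡_ (neighbour v)
  neighbour-injective v =
    lookup-injective (Unique.filter⁺ (T? ∘ adj G v) (Unique.allFin⁺ (n G)))

  injective-neighbours⇒≤degree : ∀ {r} v (g : Fin r → Vertex G) → Injective _≡_ _≡_ g →
    (∀ i → Adj G v (g i)) → r ≤ degree G v
  injective-neighbours⇒≤degree v g g-injective g-adj = injective⇒≤ {f = Any.index ∘ g∈}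
    (labels-injective⇒injective (lookup (neighbours v)) g-injective (≡-sym ∘ lookup-index ∘ g∈))
    where
    g∈ : ∀ i → g i ∈ neighbours v
    g∈ i = ∈-filter⁺ (T? ∘ adj G v) (∈-allFin (g i)) (g-adj i)

  clique⇒HasMStar : ∀ {s} v (g : Fin s → Vertex G) → Injective _≡_ _≡_ g →
    (∀ i → Adj G v (g i)) → (∀ i j → i ≢ j → Adj G (g i) (g j)) → HasMStar G s
  clique⇒HasMStar {s} v g g-injective v-adj g-adj =
    v , g , g-injective , λ i → v-adj i ,
      injective-neighbours⇒≤degree (g i) (nbhd i) (nbhd-injective i) (nbhd-adj i)
    where
    nbhd : Fin s → Fin s → Vertex G
    nbhd i j with j ≟ i
    ... | yes _ = v
    ... | no _ = g j
    nbhd-injective : ∀ i → Injective _≡_ _≡_ (nbhd i)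
    nbhd-injective i {j} {k} eq with j ≟ i | k ≟ i
    ... | yes j≡i | yes k≡i = trans j≡i (≡-sym k≡i)
    ... | yes _   | no _    = ⊥-elim (adj⇒≢ (v-adj k) eq)
    ... | no _    | yes _   = ⊥-elim (adj⇒≢ (v-adj j) (≡-sym eq))
    ... | no _    | no _    = g-injective eq
    nbhd-adj : ∀ i j → Adj G (g i) (nbhd i j)
    nbhd-adj i j with j ≟ i
    ... | yes _ = adj-sym (v-adj i)
    ... | no j≢i = g-adj i j (≢-sym j≢i)

module Colourings (G : Graph) where
  open Neighbourhood G

  Sees : (Vertex G → ℕ) → Vertex G → ℕ → Set
  Sees c v j = ∃ λ w → Adj G v w × c w ≡ j

  sees? : ∀ c v j → Dec (Sees c v j)
  sees? c v j = any? λ w → T? (adj G v w) ×-dec (c w ≟ℕ j)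

  Missing : ∀ {k} → (Vertex G → ℕ) → Vertex G → Fin k → Set
  Missing c v i = colour i ≢ c v × ¬ Sees c v (colour i)

  missing? : ∀ {k} c v (i : Fin k) → Dec (Missing c v i)
  missing? c v i = ¬? (colour i ≟ℕ c v) ×-dec ¬? (sees? c v (colour i))

  bVertex-or-missing : ∀ k c v → IsBVertex G k c v ⊎ ∃ (Missing {k} c v)
  bVertex-or-missing k c v with any? (missing? c v)
  ... | yes missing = inj₂ missing
  ... | no none = inj₁ λ j 1≤j j≤k j≢cv →
    let i , i↦j = colour-surjective 1≤j j≤k in
    subst (Sees c v) i↦j (decidable-stable (sees? c v (colour i))
      λ unseen → none (i , subst (_≢ c v) (≡-sym i↦j) j≢cv , unseen))

  Rainbow : (Vertex G → ℕ) → Vertex G → Set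
  Rainbow c v = ∀ {a b} → Adj G v a → Adj G v b → a ≢ b → c a ≢ 0 → c a ≢ c b

  bVertex⇒≤degree : ∀ {k} c w → 1 ≤ c w × c w ≤ suc k → IsBVertex G (suc k) c w →
    k ≤ degree G w
  bVertex⇒≤degree {k} c w (1≤cw , cw≤) bv =
    injective-neighbours⇒≤degree w (proj₁ ∘ seen) seen-injective (proj₁ ∘ proj₂ ∘ seen)
    where
    own : ∃ λ (p : Fin (suc k)) → colour p ≡ c w
    own = colour-surjective 1≤cw cw≤
    other : Fin k → ℕ
    other l = colour (punchIn (proj₁ own) l)
    seen : ∀ l → Sees c w (other l)
    seen l = bv (other l) (s≤s z≤n) (toℕ<n (punchIn (proj₁ own) l))
      λ eq → punchInᵢ≢i (proj₁ own) l (colour-injective (trans eq (≡-sym (proj₂ own))))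
    seen-injective : Injective _≡_ _≡_ (proj₁ ∘ seen)
    seen-injective = labels-injective⇒injective c
      (punchIn-injective (proj₁ own) _ _ ∘ colour-injective) (proj₂ ∘ proj₂ ∘ seen)

  -- Pigeonhole: with a missing colour, v, that colour and the neighbours of v would need
  -- 2 + d(v) ≤ k + 1 distinct colours.
  rainbow⇒bVertex : ∀ {k} c v → (∀ w → 1 ≤ c w × c w ≤ suc k) →
    (∀ {w} → Adj G v w → c v ≢ c w) → Rainbow c v → k ≤ degree G v → IsBVertex G (suc k) c v
  rainbow⇒bVertex {k} c v range proper rainbow k≤d with bVertex-or-missing (suc k) c v
  ... | inj₁ bv = bv
  ... | inj₂ (i , i≢v , unseen) = ⊥-elim (<⇒≱ (s≤s⁻¹ (injective-colours⇒≤ palette palette-range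
        (◂-injective fresh-v (◂-injective fresh-i neighbour-colours-injective)))) k≤d)
    where
    palette : Fin (suc (suc (degree G v))) → ℕ
    palette = c v ◂ (colour i ◂ (c ∘ neighbour v))
    palette-range : ∀ a → 1 ≤ palette a × palette a ≤ suc k
    palette-range zero = range v
    palette-range (suc zero) = colour-range i
    palette-range (suc (suc l)) = range (neighbour v l)
    neighbour-colours-injective : Injective _≡_ _≡_ (c ∘ neighbour v)
    neighbour-colours-injective {a} {b} eq = neighbour-injective v (decidable-stable (_ ≟ _)
      λ a≢b → rainbow (neighbour-adj v a) (neighbour-adj v b) a≢b (>⇒≢ (proj₁ (range _))) eq)
    fresh-i : ∀ l → c (neighbour v l) ≢ colour i
    fresh-i l eq = unseen (neighbour v l , neighbour-adj v l , eq)
    fresh-v : ∀ a → (colour i ◂ (c ∘ neighbour v)) a ≢ c v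
    fresh-v zero = i≢v
    fresh-v (suc l) = ≢-sym (proper (neighbour-adj v l))

module BlockGraphs (G : Graph) (block-graph : BlockGraph G) where
  open Walks G
  open Paths G

  InBlock : Subset (n G) → Set₁
  InBlock s = ∃ λ b → s ⊆ b × IsBlock G (_∈ˢ b)

  -- IsBlock demands maximality among arbitrary predicates, which can only be compared with
  -- subsets classically.
  maximal⇒block : ∀ s → NonSeparable G (_∈ˢ s) → ¬ (∃ λ t → s ⊂ t × NonSeparable G (_∈ˢ t)) →
    IsBlock G (_∈ˢ s)
  maximal⇒block s ns maximal = ns , λ S' s⊆S' ns' v v∈S' → decidable-stable (v ∈? s) λ v∉s →
    ¬¬-decidable S' λ S'? → maximal (subset S'? ,
      (∈-subset⁺ S'? ∘ s⊆S' _ , v , ∈-subset⁺ S'? v∈S' , v∉s) ,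
      nonSeparable-resp (∈-subset⁺ S'?) (∈-subset⁻ S'?) ns')

  ¬¬-inBlock : ∀ s → NonSeparable G (_∈ˢ s) → ¬ ¬ InBlock s
  ¬¬-inBlock = WF.All.wfRec ⊃-wellFounded _ _ extend
    where
    extend : ∀ s → (∀ {t} → t ⊃ s → NonSeparable G (_∈ˢ t) → ¬ ¬ InBlock t) →
      NonSeparable G (_∈ˢ s) → ¬ ¬ InBlock s
    extend s larger ns k =
      ¬¬-excluded-middle {A = ∃ λ t → s ⊂ t × NonSeparable G (_∈ˢ t)} λ where
        (yes (t , s⊂t , ns-t)) →
          larger s⊂t ns-t λ (b , t⊆b , block) → k (b , t⊆b ∘ proj₁ s⊂t , block)
        (no maximal) → k (s , id , maximal⇒block s ns maximal)

  nonSeparable⇒clique : ∀ {S} → NonSeparable G S → IsClique G S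
  nonSeparable⇒clique {S} ns a b a∈ b∈ a≢b = decidable-stable (T? (adj G a b)) λ ¬ab →
    ¬¬-decidable S λ S? →
    ¬¬-inBlock (subset S?) (nonSeparable-resp (∈-subset⁺ S?) (∈-subset⁻ S?) ns)
      λ (t , S⊆t , block) →
    ¬ab (block-graph _ block a b (S⊆t (∈-subset⁺ S? a∈)) (S⊆t (∈-subset⁺ S? b∈)) a≢b)

  walk-ends-adjacent : ∀ {S y a b} → ¬ S y → WalkIn G S a b → Adj G y a → Adj G y b →
    a ≢ b → Adj G a b
  walk-ends-adjacent y∉S w ya yb a≢b =
    let _ , p , inS = loop-erase w in
    nonSeparable⇒clique (cycle-nonSeparable p (y∉S ∘ inS) ya yb) _ _
      (inj₂ (first∈ p)) (inj₂ (last∈ p)) a≢b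

  two-common-neighbours⇒adjacent : ∀ {y z a b} → Adj G y a → Adj G y b → Adj G z a → Adj G z b →
    y ≢ z → a ≢ b → Adj G a b
  two-common-neighbours⇒adjacent {y} {z} {a} {b} ya yb za zb y≢z =
    walk-ends-adjacent {S = _≢ y} (λ y≢y → y≢y refl) a⟶z⟶b ya yb
    where
    a⟶z⟶b : WalkIn G (_≢ y) a b
    a⟶z⟶b = step (≢-sym (adj⇒≢ ya)) (adj-sym za) (step (≢-sym y≢z) zb (here (≢-sym (adj⇒≢ yb))))

bStar⇒mStar : ∀ G k → HasBStarColoring G (suc k) → HasMStar G k
bStar⇒mStar G k (c , (range , _) , w₀ , _ , _ , b-neighbour) =
  w₀ , w , w-injective , λ i → w-adj i , bVertex⇒≤degree c (w i) (range (w i)) (w-bVertex i)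
  where
  open Colourings G
  chosen : ∀ (i : Fin k) → ∃ λ w → Adj G w₀ w × c w ≡ colour i × IsBVertex G (suc k) c w
  chosen i = b-neighbour (colour i) (s≤s z≤n) (s≤s (toℕ<n i))
  w : Fin k → Vertex G
  w = proj₁ ∘ chosen
  w-adj : ∀ i → Adj G w₀ (w i)
  w-adj = proj₁ ∘ proj₂ ∘ chosen
  w-colour : ∀ i → c (w i) ≡ colour i
  w-colour = proj₁ ∘ proj₂ ∘ proj₂ ∘ chosen
  w-bVertex : ∀ i → IsBVertex G (suc k) c (w i)
  w-bVertex = proj₂ ∘ proj₂ ∘ proj₂ ∘ chosen
  w-injective : Injective _≡_ _≡_ w
  w-injective = labels-injective⇒injective c colour-injective w-colour

module GreedyColouring (G : Graph) (block-graph : BlockGraph G) (m : ℕ)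
  (m-maximum : ∀ k → HasMStar G k → k ≤ m)
  (u : Vertex G) (f : Fin m → Vertex G) (f-injective : Injective _≡_ _≡_ f)
  (f-adj : ∀ i → Adj G u (f i)) (f-degree : ∀ i → m ≤ degree G (f i)) where

  open Walks G
  open Colourings G
  open Neighbourhood G using (clique⇒HasMStar)
  open BlockGraphs G block-graph

  -- A partial colouring gives the uncoloured vertices the value 0, which no colour takes.
  Colouring : Set
  Colouring = Vertex G → ℕ

  Coloured : Colouring → VSet G
  Coloured c v = c v ≢ 0

  coloured-as : ∀ {x k} → x ≡ suc k → x ≢ 0
  coloured-as refl = 1+n≢0

  coloured? : ∀ c v → Dec (Coloured c v)
  coloured? c v = ¬? (c v ≟ℕ 0)

  coloured : Colouring → Subset (n G)
  coloured c = subset (coloured? c)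

  Anywhere : VSet G
  Anywhere _ = ⊤

  record Invariant (c : Colouring) : Set where
    field
      u-colour : c u ≡ suc m
      f-colour : ∀ i → c (f i) ≡ colour i
      bounded  : ∀ v → c v ≤ suc m
      proper   : ∀ {a b} → Adj G a b → Coloured c a → c a ≢ c b
      reroute  : ∀ {a b} → Coloured c a → Coloured c b → WalkIn G Anywhere a b →
                 WalkIn G (Coloured c) a b
      phase    : (∀ v → Coloured c v → v ≡ u ⊎ Adj G u v) ⊎ (∀ v → Adj G u v → Coloured c v)
      f-status : ∀ i → IsBVertex G (suc m) c (f i) ⊎ Rainbow c (f i)

    u-coloured : Coloured c u
    u-coloured = coloured-as u-colour

    f-coloured : ∀ i → Coloured c (f i)
    f-coloured i = coloured-as (f-colour i)

    coloured-neighbours-adjacent : ∀ {y a b} → c y ≡ 0 → Adj G y a → Adj G y b →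
      Coloured c a → Coloured c b → a ≢ b → Adj G a b
    coloured-neighbours-adjacent cy ya yb ca cb =
      walk-ends-adjacent (λ cy≢0 → cy≢0 cy)
        (reroute ca cb (step tt (adj-sym ya) (step tt yb (here tt)))) ya yb

  -- The coloured neighbours of y form a clique in N(y), so by maximality of m there are at
  -- most m of them.
  free-colour : ∀ {c y} → Invariant c → c y ≡ 0 → ∃ λ (j : Fin (suc m)) → ¬ Sees c y (colour j)
  free-colour {c} {y} I cy with any? (λ j → ¬? (sees? c y (colour j)))
  ... | yes free = free
  ... | no none = ⊥-elim (1+n≰n (m-maximum (suc m)
        (clique⇒HasMStar y (proj₁ ∘ seen) seen-injective (proj₁ ∘ proj₂ ∘ seen) seen-clique)))
    where
    open Invariant I
    seen : ∀ j → Sees c y (colour j)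
    seen j = decidable-stable (sees? c y (colour j)) (λ unseen → none (j , unseen))
    seen-colour : ∀ j → c (proj₁ (seen j)) ≡ colour j
    seen-colour = proj₂ ∘ proj₂ ∘ seen
    seen-injective : Injective _≡_ _≡_ (proj₁ ∘ seen)
    seen-injective = labels-injective⇒injective c colour-injective seen-colour
    seen-clique : ∀ i j → i ≢ j → Adj G (proj₁ (seen i)) (proj₁ (seen j))
    seen-clique i j i≢j =
      coloured-neighbours-adjacent cy (proj₁ (proj₂ (seen i))) (proj₁ (proj₂ (seen j)))
        (coloured-as (seen-colour i)) (coloured-as (seen-colour j)) (i≢j ∘ seen-injective)

  NeighbourhoodFirst : Colouring → Vertex G → Set
  NeighbourhoodFirst c y = Adj G u y ⊎ (∀ v → c v ≡ 0 → ¬ Adj G u v)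

  Attached : Colouring → Vertex G → Set
  Attached c y = (∃ λ z → Coloured c z × Adj G y z) ⊎
                 (∀ {v w} → ¬ Coloured c v → Coloured c w → ¬ Adj G v w)

  Admissible : Colouring → Vertex G → ℕ → Set
  Admissible c y q =
    ¬ Sees c y q × (∀ i → Adj G y (f i) → IsBVertex G (suc m) c (f i) ⊎ ¬ Sees c (f i) q)

  admissible-next-to-u : ∀ {c y} → Invariant c → c y ≡ 0 → Adj G u y →
    ∃ λ j → Admissible c y (colour j)
  admissible-next-to-u {c} {y} I cy uy with Invariant.phase I | free-colour I cy
  ... | inj₂ N[u]-coloured | _ = ⊥-elim (N[u]-coloured y uy cy)
  ... | inj₁ inside-N[u] | j , unseen = j , unseen , λ i yf → inj₂ (unseen-at-f i yf)
    where
    unseen-at-f : ∀ i → Adj G y (f i) → ¬ Sees c (f i) (colour j)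
    unseen-at-f i yf (w , fw , cw) with inside-N[u] w (coloured-as cw)
    ... | inj₁ refl = unseen (u , adj-sym uy , cw)
    ... | inj₂ uw = unseen (w , two-common-neighbours⇒adjacent uy uw (adj-sym yf) fw
                                  (adj⇒≢ (f-adj i)) (λ { refl → coloured-as cw cy }) , cw)

  admissible-missing : ∀ {c y i} (j : Fin (suc m)) → Invariant c → c y ≡ 0 →
    (∀ v → c v ≡ 0 → ¬ Adj G u v) → Adj G y (f i) → Missing c (f i) j → Admissible c y (colour j)
  admissible-missing {c} {y} {i} j I cy saturated yf (j≢f , unseen-f) = unseen-y , at-f
    where
    open Invariant I
    unseen-y : ¬ Sees c y (colour j)
    unseen-y (w , yw , cw) with w ≟ f i
    ... | yes refl = j≢f (≡-sym cw)
    ... | no w≢f = unseen-f (w , adj-sym fw , cw)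
      where
      fw : Adj G w (f i)
      fw = coloured-neighbours-adjacent cy yw yf (coloured-as cw) (f-coloured i) w≢f
    at-f : ∀ i' → Adj G y (f i') →
      IsBVertex G (suc m) c (f i') ⊎ ¬ Sees c (f i') (colour j)
    at-f i' yf' with i' ≟ i
    ... | yes refl = inj₂ unseen-f
    ... | no i'≢i = ⊥-elim (saturated y cy (two-common-neighbours⇒adjacent
          (adj-sym (f-adj i)) (adj-sym yf) (adj-sym (f-adj i')) (adj-sym yf')
          (i'≢i ∘ f-injective ∘ ≡-sym) (λ { refl → u-coloured cy })))

  admissible-colour : ∀ {c y} → Invariant c → c y ≡ 0 → NeighbourhoodFirst c y →
    ∃ λ j → Admissible c y (colour j)
  admissible-colour I cy (inj₁ uy) = admissible-next-to-u I cy uy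
  admissible-colour {c} {y} I cy (inj₂ saturated)
    with any? (λ i → T? (adj G y (f i)) ×-dec any? (missing? c (f i)))
  ... | yes (i , yf , j , missing) = j , admissible-missing j I cy saturated yf missing
  ... | no none = let j , unseen = free-colour I cy in j , unseen , λ i yf →
    inj₁ (fromInj₁ (λ missing → ⊥-elim (none (i , yf , missing)))
                   (bVertex-or-missing (suc m) c (f i)))

  module Extension {c y} (I : Invariant c) (cy : c y ≡ 0)
    (j : Fin (suc m)) (admissible : Admissible c y (colour j)) where

    open Invariant I

    c' : Colouring
    c' = updateAt c y (const (colour j))

    c'-y : c' y ≡ colour j
    c'-y = updateAt-updates y c

    c'-other : ∀ {v} → v ≢ y → c' v ≡ c v
    c'-other {v} = updateAt-minimal v y c

    c'-old : ∀ {v} → Coloured c v → c' v ≡ c v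
    c'-old cv = c'-other λ { refl → cv cy }

    clash-at-y : ∀ {b} → b ≢ y → c' y ≡ c' b → c b ≡ colour j
    clash-at-y b≢y eq = trans (≡-sym (c'-other b≢y)) (trans (≡-sym eq) c'-y)

    clash-elsewhere : ∀ {a b} → a ≢ y → b ≢ y → c' a ≡ c' b → c a ≡ c b
    clash-elsewhere a≢y b≢y eq = trans (≡-sym (c'-other a≢y)) (trans eq (c'-other b≢y))

    y-coloured : Coloured c' y
    y-coloured = coloured-as c'-y

    coloured⁺ : ∀ {v} → Coloured c v → Coloured c' v
    coloured⁺ cv = cv ∘ trans (≡-sym (c'-old cv))

    coloured⁻ : ∀ {v} → Coloured c' v → v ≡ y ⊎ Coloured c v
    coloured⁻ {v} cv with v ≟ y
    ... | yes v≡y = inj₁ v≡y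
    ... | no v≢y = inj₂ (cv ∘ trans (c'-other v≢y))

    coloured-grows : coloured c ⊂ coloured c'
    coloured-grows = ∈-subset⁺ (coloured? c') ∘ coloured⁺ ∘ ∈-subset⁻ (coloured? c) ,
      y , ∈-subset⁺ (coloured? c') y-coloured , λ y∈ → ∈-subset⁻ (coloured? c) y∈ cy

    bVertex⁺ : ∀ {v} → Coloured c v → IsBVertex G (suc m) c v → IsBVertex G (suc m) c' v
    bVertex⁺ cv bv (suc k) 1≤k k≤ k≢ with bv (suc k) 1≤k k≤ (k≢ ∘ λ eq → trans eq (≡-sym (c'-old cv)))
    ... | w , vw , cw = w , vw , trans (c'-old (coloured-as cw)) cw

    rainbow⁺ : ∀ {v} → Rainbow c v → (Adj G v y → ¬ Sees c v (colour j)) → Rainbow c' v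
    rainbow⁺ {v} rainbow unseen {a} {b} va vb a≢b ca with a ≟ y | b ≟ y
    ... | yes refl | yes refl = ⊥-elim (a≢b refl)
    ... | yes refl | no b≢y = λ eq → unseen va (b , vb , clash-at-y b≢y eq)
    ... | no a≢y | yes refl = λ eq → unseen vb (a , va , clash-at-y a≢y (≡-sym eq))
    ... | no a≢y | no b≢y = rainbow va vb a≢b (ca ∘ trans (c'-other a≢y)) ∘ clash-elsewhere a≢y b≢y

    bounded' : ∀ v → c' v ≤ suc m
    bounded' v with v ≟ y
    ... | yes refl = subst (_≤ suc m) (≡-sym c'-y) (toℕ<n j)
    ... | no v≢y = subst (_≤ suc m) (≡-sym (c'-other v≢y)) (bounded v)

    proper' : ∀ {a b} → Adj G a b → Coloured c' a → c' a ≢ c' b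
    proper' {a} {b} ab ca with a ≟ y | b ≟ y
    ... | yes refl | yes refl = ⊥-elim (adj⇒≢ ab refl)
    ... | yes refl | no b≢y = λ eq → proj₁ admissible (b , ab , clash-at-y b≢y eq)
    ... | no a≢y | yes refl = λ eq → proj₁ admissible (a , adj-sym ab , clash-at-y a≢y (≡-sym eq))
    ... | no a≢y | no b≢y = proper ab (ca ∘ trans (c'-other a≢y)) ∘ clash-elsewhere a≢y b≢y

    from-y : ∀ {b} → Attached c y → Coloured c b → WalkIn G Anywhere y b →
      WalkIn G (Coloured c') y b
    from-y attached cb w with attached
    ... | inj₁ (z , cz , yz) =
      step y-coloured yz (mapʷ coloured⁺ (reroute cz cb (step tt (adj-sym yz) w)))
    ... | inj₂ isolated =
      let v , w' , ¬cv , cw' , vw' = crossing-edge (coloured? c) w (λ cy≢0 → cy≢0 cy) cb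
      in ⊥-elim (isolated ¬cv cw' vw')

    reroute' : Attached c y → ∀ {a b} → Coloured c' a → Coloured c' b → WalkIn G Anywhere a b →
      WalkIn G (Coloured c') a b
    reroute' attached ca cb w with coloured⁻ ca | coloured⁻ cb
    ... | inj₁ refl | inj₁ refl = here y-coloured
    ... | inj₁ refl | inj₂ cb₀ = from-y attached cb₀ w
    ... | inj₂ ca₀ | inj₁ refl = reverseʷ (from-y attached ca₀ (reverseʷ w))
    ... | inj₂ ca₀ | inj₂ cb₀ = mapʷ coloured⁺ (reroute ca₀ cb₀ w)

    phase' : NeighbourhoodFirst c y →
      (∀ v → Coloured c' v → v ≡ u ⊎ Adj G u v) ⊎ (∀ v → Adj G u v → Coloured c' v)
    phase' first with phase | first
    ... | inj₂ N[u]-coloured | _ = inj₂ λ v uv → coloured⁺ (N[u]-coloured v uv)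
    ... | inj₁ inside-N[u] | inj₁ uy =
      inj₁ λ v cv → [ (λ { refl → inj₂ uy }) , inside-N[u] v ] (coloured⁻ cv)
    ... | inj₁ _ | inj₂ saturated = inj₂ λ v uv → coloured⁺ λ cv≡0 → saturated v cv≡0 uv

    f-status' : ∀ i → IsBVertex G (suc m) c' (f i) ⊎ Rainbow c' (f i)
    f-status' i with f-status i | T? (adj G y (f i))
    ... | inj₁ bv | _ = inj₁ (bVertex⁺ (f-coloured i) bv)
    ... | inj₂ rainbow | no ¬yf = inj₂ (rainbow⁺ rainbow λ fy → ⊥-elim (¬yf (adj-sym fy)))
    ... | inj₂ rainbow | yes yf with proj₂ admissible i yf
    ...   | inj₁ bv = inj₁ (bVertex⁺ (f-coloured i) bv)
    ...   | inj₂ unseen = inj₂ (rainbow⁺ rainbow λ _ → unseen)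

    invariant : NeighbourhoodFirst c y → Attached c y → Invariant c'
    invariant first attached = record
      { u-colour = trans (c'-old u-coloured) u-colour
      ; f-colour = λ i → trans (c'-old (f-coloured i)) (f-colour i)
      ; bounded = bounded'
      ; proper = proper'
      ; reroute = reroute' attached
      ; phase = phase' first
      ; f-status = f-status'
      }

  next-vertex : ∀ {c y₀} → Invariant c → c y₀ ≡ 0 →
    ∃ λ y → c y ≡ 0 × NeighbourhoodFirst c y × Attached c y
  next-vertex {c} {y₀} I cy₀ with any? (λ v → (c v ≟ℕ 0) ×-dec T? (adj G u v))
  ... | yes (y , cy , uy) = y , cy , inj₁ uy , inj₁ (u , Invariant.u-coloured I , adj-sym uy)
  ... | no none-at-u
    with any? (λ v → (c v ≟ℕ 0) ×-dec any? (λ z → coloured? c z ×-dec T? (adj G v z)))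
  ...   | yes (y , cy , attached) =
          y , cy , inj₂ (λ v cv uv → none-at-u (v , cv , uv)) , inj₁ attached
  ...   | no none-attached = y₀ , cy₀ , inj₂ (λ v cv uv → none-at-u (v , cv , uv)) ,
          inj₂ λ ¬cv cw vw → none-attached (_ , decidable-stable (_ ≟ℕ 0) ¬cv , _ , cw , vw)

  Completion : Set
  Completion = ∃ λ c → Invariant c × (∀ v → Coloured c v)

  complete : ∀ {c} → Invariant c → Completion
  complete {c} = WF.All.wfRec (On.wellFounded coloured ⊃-wellFounded) _ _ extend c
    where
    extend : ∀ c → (∀ {c'} → coloured c' ⊃ coloured c → Invariant c' → Completion) →
      Invariant c → Completion
    extend c more I with any? (λ v → c v ≟ℕ 0)
    ... | no none = c , I , λ v cv≡0 → none (v , cv≡0)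
    ... | yes (y₀ , cy₀) =
      let y , cy , first , attached = next-vertex I cy₀
          j , admissible = admissible-colour I cy first
          open Extension I cy j admissible
      in more coloured-grows (invariant first attached)

  c₀ : Colouring
  c₀ v with v ≟ u | any? (λ i → f i ≟ v)
  ... | yes _ | _ = suc m
  ... | no _ | yes (i , _) = colour i
  ... | no _ | no _ = 0

  c₀-u : c₀ u ≡ suc m
  c₀-u with u ≟ u
  ... | yes _ = refl
  ... | no u≢u = ⊥-elim (u≢u refl)

  c₀-f : ∀ i → c₀ (f i) ≡ colour i
  c₀-f i with f i ≟ u | any? (λ i' → f i' ≟ f i)
  ... | yes fi≡u | _ = ⊥-elim (adj⇒≢ (f-adj i) (≡-sym fi≡u))
  ... | no _ | yes (i' , fi'≡fi) = cong colour (f-injective fi'≡fi)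
  ... | no _ | no none = ⊥-elim (none (i , refl))

  c₀-support : ∀ {v} → Coloured c₀ v → v ≡ u ⊎ ∃ λ i → f i ≡ v
  c₀-support {v} cv with v ≟ u | any? (λ i → f i ≟ v)
  ... | yes v≡u | _ = inj₁ v≡u
  ... | no _ | yes fi≡v = inj₂ fi≡v
  ... | no _ | no _ = ⊥-elim (cv refl)

  c₀-bounded : ∀ v → c₀ v ≤ suc m
  c₀-bounded v with v ≟ u | any? (λ i → f i ≟ v)
  ... | yes _ | _ = ≤-refl
  ... | no _ | yes (i , _) = m≤n⇒m≤1+n (toℕ<n i)
  ... | no _ | no _ = z≤n

  c₀-injective : ∀ {a b} → Coloured c₀ a → c₀ a ≡ c₀ b → a ≡ b
  c₀-injective {a} {b} ca eq with c₀-support ca | c₀-support (ca ∘ trans eq)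
  ... | inj₁ refl | inj₁ refl = refl
  ... | inj₁ refl | inj₂ (i , refl) =
    ⊥-elim (colour≢1+k i (trans (≡-sym (c₀-f i)) (trans (≡-sym eq) c₀-u)))
  ... | inj₂ (i , refl) | inj₁ refl =
    ⊥-elim (colour≢1+k i (trans (≡-sym (c₀-f i)) (trans eq c₀-u)))
  ... | inj₂ (i , refl) | inj₂ (i' , refl) =
    cong f (colour-injective (trans (≡-sym (c₀-f i)) (trans eq (c₀-f i'))))

  initial : Invariant c₀
  initial = record
    { u-colour = c₀-u
    ; f-colour = c₀-f
    ; bounded = c₀-bounded
    ; proper = λ ab ca → adj⇒≢ ab ∘ c₀-injective ca
    ; reroute = λ ca cb _ → connected-via u to-u _ _ ca cb
    ; phase = inj₁ λ v cv → [ inj₁ , (λ { (i , refl) → inj₂ (f-adj i) }) ] (c₀-support cv)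
    ; f-status = λ i → inj₂ λ _ _ a≢b ca → a≢b ∘ c₀-injective ca
    }
    where
    to-u : ∀ v → Coloured c₀ v → WalkIn G (Coloured c₀) v u
    to-u v cv with c₀-support cv
    ... | inj₁ refl = here cv
    ... | inj₂ (i , refl) = step cv (adj-sym (f-adj i)) (here (coloured-as c₀-u))

  bStar-colouring : ∀ {c} → Invariant c → (∀ v → Coloured c v) → IsBStarColoring G (suc m) c
  bStar-colouring {c} I total =
    (range , λ a b ab → proper ab (total a)) , u , u-colour , u-bVertex ,
    λ k 1≤k k<1+m → let i , fi↦k = f-coloured-as 1≤k (s≤s⁻¹ k<1+m) in
      f i , f-adj i , fi↦k , f-bVertex i
    where
    open Invariant I
    range : ∀ v → 1 ≤ c v × c v ≤ suc m
    range v = n≢0⇒n>0 (total v) , bounded v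
    f-coloured-as : ∀ {k} → 1 ≤ k → k ≤ m → ∃ λ i → c (f i) ≡ k
    f-coloured-as 1≤k k≤m = let i , i↦k = colour-surjective 1≤k k≤m in i , trans (f-colour i) i↦k
    u-bVertex : IsBVertex G (suc m) c u
    u-bVertex k 1≤k k≤1+m k≢cu =
      let k≢1+m = k≢cu ∘ λ eq → trans eq (≡-sym u-colour)
          i , fi↦k = f-coloured-as 1≤k (m<1+n⇒m≤n (≤∧≢⇒< k≤1+m k≢1+m))
      in f i , f-adj i , fi↦k
    f-bVertex : ∀ i → IsBVertex G (suc m) c (f i)
    f-bVertex i with f-status i
    ... | inj₁ bv = bv
    ... | inj₂ rainbow =
      rainbow⇒bVertex c (f i) range (λ fw → proper fw (total (f i))) rainbow (f-degree i)

proposition5 : (G : Graph) → BlockGraph G → (m : ℕ) →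
    IsMaximum (HasMStar G) m → IsMaximum (HasBStarColoring G) (suc m)
proposition5 G block-graph m ((u , f , f-injective , f-prop) , m-maximum) = lower , upper
  where
  open GreedyColouring G block-graph m m-maximum u f f-injective (proj₁ ∘ f-prop) (proj₂ ∘ f-prop)
  lower : HasBStarColoring G (suc m)
  lower = let c , I , total = complete initial in c , bStar-colouring I total
  upper : ∀ k → HasBStarColoring G k → k ≤ suc m
  upper zero _ = z≤n
  upper (suc k) b = s≤s (m-maximum k (bStar⇒mStar G k b))
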